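{- Let $m,n,s,t$ be positive integers with $2m\geqslant n$ and $2\nmid t$. Then $(-q;q)_m\left[{2^st \atop n}\right]_q$ is divisible (in the ring $\mathbb{Z}[q]$) by $(1+q)^{\lfloor (m-1)/2\rfloor}[2^s]_{q^t}$, where $\lfloor \alpha\rfloor$ denotes the greatest integer not exceeding the real number $\alpha$.
   Context: Notation: $(a;q)_k=\prod_{0\leqslant j<k}(1-aq^j)$ for $k\in\mathbb{N}$ (an empty product equals $1$), so $(-q;q)_m=\prod_{0<j\leqslant m}(1+q^j)$. For $k\in\mathbb{N}$, $[k]_q=\frac{1-q^k}{1-q}=\sum_{0\leqslant j<k}q^j$, and hence $[2^s]_{q^t}=\frac{1-q^{2^st}}{1-q^t}$. For $n,k\in\mathbb{N}$ with $k\leqslant n$, the $q$-binomial coefficient is $\left[{n \atop k}\right]_q=\frac{(q;q)_n}{(q;q)_k(q;q)_{n-k}}$, and $\left[{n \atop k}\right]_q=0$ if $k>n$; these are polynomials in $q$ with integer coefficients. -}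

module Defs where

open import Data.Nat as ℕ using (ℕ; zero; suc)
open import Data.Integer as ℤ using (ℤ; 0ℤ; 1ℤ)
open import Data.List using (List; []; _∷_; replicate; _++_; map; foldr; upTo)
open import Data.Product using (∃)
open import Relation.Binary.PropositionalEquality using (_≡_)

-- Polynomials in ℤ[q], as coefficient lists (lowest degree first).
-- Trailing zeros are allowed; equality is coefficientwise (_≈P_).
Poly : Set
Poly = List ℤ

coeff : Poly → ℕ → ℤ
coeff []       _       = 0ℤ
coeff (a ∷ _)  zero    = a
coeff (_ ∷ p)  (suc i) = coeff p i

infix 4 _≈P_
_≈P_ : Poly → Poly → Set
p ≈P r = ∀ i → coeff p i ≡ coeff r i

infixl 6 _+P_
_+P_ : Poly → Poly → Poly
[]      +P r       = r
(a ∷ p) +P []      = a ∷ p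
(a ∷ p) +P (b ∷ r) = (a ℤ.+ b) ∷ (p +P r)

_·P_ : ℤ → Poly → Poly
a ·P p = map (a ℤ.*_) p

infixl 7 _*P_
_*P_ : Poly → Poly → Poly
[]      *P r = []
(a ∷ p) *P r = (a ·P r) +P (0ℤ ∷ (p *P r))

oneP : Poly
oneP = 1ℤ ∷ []

X^ : ℕ → Poly
X^ k = replicate k 0ℤ ++ (1ℤ ∷ [])

infixr 8 _^P_
_^P_ : Poly → ℕ → Poly
p ^P zero  = oneP
p ^P suc k = p *P (p ^P k)

infix 4 _∣P_
_∣P_ : Poly → Poly → Set
d ∣P f = ∃ λ g → f ≈P d *P g

negQPoch : ℕ → Poly
negQPoch zero    = oneP
negQPoch (suc m) = negQPoch m *P (oneP +P X^ (suc m))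

qbinom : ℕ → ℕ → Poly
qbinom n       zero    = oneP
qbinom zero    (suc k) = []
qbinom (suc n) (suc k) = qbinom n k +P (X^ (suc k) *P qbinom n (suc k))

qintAt : ℕ → ℕ → Poly
qintAt k t = foldr (λ j acc → X^ (j ℕ.* t) +P acc) [] (upTo k)

-- Let N = 2^s t, d = gcd N n and write d = 2^c g with g odd, so that g ∣ t. The absorption
-- identity (1 - q^n)[N, n] = (1 - q^N)[N - 1, n - 1] and Bézout make 1 - q^N divide (1 - q^d)[N, n].
-- Now 1 - q^d = (1 - q^g) P with P = ∏_{i<c} (1 + q^(2^i g)), and 1 - q^N = (1 - q^t)[2^s]_{q^t} is a
-- multiple of (1 - q^g)[2^s]_{q^t}; cancelling 1 - q^g, [2^s]_{q^t} divides P [N, n].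
-- As 2^(c-1) g = d/2 ≤ n/2 ≤ m, the factors of P are among those of (-q;q)_m. The remaining ones
-- include 1 + q^j for every odd j ≤ m except possibly j = g, and each of these is divisible by 1 + q.
module Submission where

open import Defs
open import Data.Nat using (ℕ; _≤_; _*_; _^_; _∸_; _/_)
open import Data.Nat.Divisibility using (_∣_)
open import Relation.Nullary using (¬_)

open import Algebra.Bundles using (CommutativeRing)
open import Algebra.Structures using (IsCommutativeRing)
open import Data.Bool using (Bool; true; false; not; _∧_; _∨_; if_then_else_)
open import Data.Bool.Properties using (∧-conicalˡ; ∧-conicalʳ; ¬-not; not-involutive)
open import Data.Integer as ℤ using (ℤ; 0ℤ; 1ℤ)
import Data.Integer.Properties as ℤ
open import Data.List using (List; []; _∷_; map; foldr; upTo; applyUpTo)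
open import Data.List.Properties using (map-applyUpTo)
open import Data.Maybe using (Maybe; just; nothing)
open import Data.Nat as ℕ using (zero; suc; _+_; _<_; s≤s; z≤n)
import Data.Nat.Properties as ℕ
open import Data.Nat.Coprimality using (Coprime; 1-coprimeTo; coprime-+; coprime-divisor)
open import Data.Nat.Divisibility using (divides; ∣-trans; ∣⇒≤)
open import Data.Nat.DivMod using (m/n≡1+[m∸n]/n)
open import Data.Nat.GCD using (gcd; gcd-GCD; gcd[m,n]∣m; gcd[m,n]∣n; gcd[m,n]≢0; module Bézout)
open import Data.Nat.Induction using (<-wellFounded)
open import Data.Product using (_,_; ∃; ∃₂)
open import Data.Sum using (_⊎_; inj₁; inj₂)
open import Function using (id; _∘_)
open import Induction.WellFounded using (Acc; acc)
open import Relation.Binary.Bundles using (Setoid)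
open import Relation.Binary.PropositionalEquality as ≡ using (_≡_; _≢_; refl; cong; cong₂)
open import Relation.Binary.Structures using (IsEquivalence)
open import Relation.Nullary using (Dec; yes; no; does)
open import Relation.Nullary.Decidable using (dec-true; dec-false)
open import Tactic.RingSolver using (solve-∀)
import Tactic.RingSolver.Core.AlmostCommutativeRing as ACR

-- The ring ℤ[q]

-- _≈P_ is wrapped in a record so that both polynomials can be inferred from a proof of it.
infix 4 _≋_
record _≋_ (p r : Poly) : Set where
  constructor mk≋
  field coeff-≡ : p ≈P r
open _≋_

≋-refl : ∀ {p} → p ≋ p
≋-refl = mk≋ λ _ → refl

≋-sym : ∀ {p r} → p ≋ r → r ≋ p
≋-sym e = mk≋ λ i → ≡.sym (coeff-≡ e i)

≋-trans : ∀ {p r u} → p ≋ r → r ≋ u → p ≋ u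
≋-trans e f = mk≋ λ i → ≡.trans (coeff-≡ e i) (coeff-≡ f i)

≋-reflexive : ∀ {p r} → p ≡ r → p ≋ r
≋-reflexive refl = ≋-refl

≋-isEquivalence : IsEquivalence _≋_
≋-isEquivalence = record { refl = ≋-refl ; sym = ≋-sym ; trans = ≋-trans }

≋-setoid : Setoid _ _
≋-setoid = record { isEquivalence = ≋-isEquivalence }

open import Relation.Binary.Reasoning.Setoid ≋-setoid

∷-cong : ∀ {a b p r} → a ≡ b → p ≋ r → a ∷ p ≋ b ∷ r
∷-cong a≡b e = mk≋ λ { zero → a≡b ; (suc i) → coeff-≡ e i }

∷-≋-[] : ∀ {a p} → a ≡ 0ℤ → p ≋ [] → a ∷ p ≋ []
∷-≋-[] a≡0 e = mk≋ λ { zero → a≡0 ; (suc i) → coeff-≡ e i }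

infix 8 -P_
-P_ : Poly → Poly
-P p = map ℤ.-_ p

infixl 6 _-P_
_-P_ : Poly → Poly → Poly
p -P r = p +P -P r

coeff-+P : ∀ p r i → coeff (p +P r) i ≡ coeff p i ℤ.+ coeff r i
coeff-+P []      r       i       = ≡.sym (ℤ.+-identityˡ _)
coeff-+P (a ∷ p) []      i       = ≡.sym (ℤ.+-identityʳ _)
coeff-+P (a ∷ p) (b ∷ r) zero    = refl
coeff-+P (a ∷ p) (b ∷ r) (suc i) = coeff-+P p r i

coeff-·P : ∀ a p i → coeff (a ·P p) i ≡ a ℤ.* coeff p i
coeff-·P a []      i       = ≡.sym (ℤ.*-zeroʳ a)
coeff-·P a (b ∷ p) zero    = refl
coeff-·P a (b ∷ p) (suc i) = coeff-·P a p i

coeff-negP : ∀ p i → coeff (-P p) i ≡ ℤ.- coeff p i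
coeff-negP []      i       = refl
coeff-negP (a ∷ p) zero    = refl
coeff-negP (a ∷ p) (suc i) = coeff-negP p i

+P-cong : ∀ {p p′ r r′} → p ≋ p′ → r ≋ r′ → p +P r ≋ p′ +P r′
+P-cong {p} {p′} {r} {r′} e f = mk≋ λ i → ≡.trans (coeff-+P p r i)
  (≡.trans (cong₂ ℤ._+_ (coeff-≡ e i) (coeff-≡ f i)) (≡.sym (coeff-+P p′ r′ i)))

·P-congˡ : ∀ a {p r} → p ≋ r → a ·P p ≋ a ·P r
·P-congˡ a {p} {r} e = mk≋ λ i → ≡.trans (coeff-·P a p i)
  (≡.trans (cong (a ℤ.*_) (coeff-≡ e i)) (≡.sym (coeff-·P a r i)))

-P-cong : ∀ {p r} → p ≋ r → -P p ≋ -P r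
-P-cong {p} {r} e = mk≋ λ i → ≡.trans (coeff-negP p i)
  (≡.trans (cong ℤ.-_ (coeff-≡ e i)) (≡.sym (coeff-negP r i)))

+P-assoc : ∀ p r u → (p +P r) +P u ≋ p +P (r +P u)
+P-assoc []      r       u       = ≋-refl
+P-assoc (a ∷ p) []      u       = ≋-refl
+P-assoc (a ∷ p) (b ∷ r) []      = ≋-refl
+P-assoc (a ∷ p) (b ∷ r) (c ∷ u) = ∷-cong (ℤ.+-assoc a b c) (+P-assoc p r u)

+P-comm : ∀ p r → p +P r ≋ r +P p
+P-comm []      []      = ≋-refl
+P-comm []      (b ∷ r) = ≋-refl
+P-comm (a ∷ p) []      = ≋-refl
+P-comm (a ∷ p) (b ∷ r) = ∷-cong (ℤ.+-comm a b) (+P-comm p r)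

+P-identityʳ : ∀ p → p +P [] ≋ p
+P-identityʳ []      = ≋-refl
+P-identityʳ (a ∷ p) = ≋-refl

-P-inverseˡ : ∀ p → -P p +P p ≋ []
-P-inverseˡ []      = ≋-refl
-P-inverseˡ (a ∷ p) = ∷-≋-[] (ℤ.+-inverseˡ a) (-P-inverseˡ p)

-P-inverseʳ : ∀ p → p +P -P p ≋ []
-P-inverseʳ p = ≋-trans (+P-comm p (-P p)) (-P-inverseˡ p)

·P-zeroˡ : ∀ p → 0ℤ ·P p ≋ []
·P-zeroˡ []      = ≋-refl
·P-zeroˡ (a ∷ p) = ∷-≋-[] (ℤ.*-zeroˡ a) (·P-zeroˡ p)

·P-identityˡ : ∀ p → 1ℤ ·P p ≋ p
·P-identityˡ []      = ≋-refl
·P-identityˡ (a ∷ p) = ∷-cong (ℤ.*-identityˡ a) (·P-identityˡ p)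

·P-congʳ : ∀ {a b} p → a ≡ b → a ·P p ≋ b ·P p
·P-congʳ p refl = ≋-refl

·P-distribˡ : ∀ a p r → a ·P (p +P r) ≋ a ·P p +P a ·P r
·P-distribˡ a []      r       = ≋-refl
·P-distribˡ a (b ∷ p) []      = ≋-refl
·P-distribˡ a (b ∷ p) (c ∷ r) = ∷-cong (ℤ.*-distribˡ-+ a b c) (·P-distribˡ a p r)

·P-distribʳ : ∀ a b p → (a ℤ.+ b) ·P p ≋ a ·P p +P b ·P p
·P-distribʳ a b []      = ≋-refl
·P-distribʳ a b (c ∷ p) = ∷-cong (ℤ.*-distribʳ-+ c a b) (·P-distribʳ a b p)

·P-assoc : ∀ a b p → a ·P (b ·P p) ≋ (a ℤ.* b) ·P p
·P-assoc a b []      = ≋-refl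
·P-assoc a b (c ∷ p) = ∷-cong (≡.sym (ℤ.*-assoc a b c)) (·P-assoc a b p)

*P-zeroʳ : ∀ p → p *P [] ≋ []
*P-zeroʳ []      = ≋-refl
*P-zeroʳ (a ∷ p) = ∷-≋-[] refl (*P-zeroʳ p)

*P-vanishˡ : ∀ {p} r → p ≋ [] → p *P r ≋ []
*P-vanishˡ {[]}    r e = ≋-refl
*P-vanishˡ {a ∷ p} r e = begin
  a ·P r +P (0ℤ ∷ p *P r)  ≈⟨ +P-cong (·P-congʳ r (coeff-≡ e 0)) (∷-≋-[] refl (*P-vanishˡ r e′)) ⟩
  0ℤ ·P r +P []            ≈⟨ +P-cong (·P-zeroˡ r) ≋-refl ⟩
  []                       ∎
  where
  e′ : p ≋ []
  e′ = mk≋ λ i → coeff-≡ e (suc i)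

*P-congˡ : ∀ p {r r′} → r ≋ r′ → p *P r ≋ p *P r′
*P-congˡ []      e = ≋-refl
*P-congˡ (a ∷ p) e = +P-cong (·P-congˡ a e) (∷-cong refl (*P-congˡ p e))

*P-congʳ : ∀ {p p′} r → p ≋ p′ → p *P r ≋ p′ *P r
*P-congʳ {[]}    {[]}     r e = ≋-refl
*P-congʳ {[]}    {a ∷ p′} r e = ≋-sym (*P-vanishˡ r (≋-sym e))
*P-congʳ {a ∷ p} {[]}     r e = *P-vanishˡ r e
*P-congʳ {a ∷ p} {b ∷ p′} r e =
  +P-cong (·P-congʳ r (coeff-≡ e 0)) (∷-cong refl (*P-congʳ {p} {p′} r (mk≋ λ i → coeff-≡ e (suc i))))

*P-cong : ∀ {p p′ r r′} → p ≋ p′ → r ≋ r′ → p *P r ≋ p′ *P r′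
*P-cong {p′ = p′} {r = r} e f = ≋-trans (*P-congʳ r e) (*P-congˡ p′ f)

*P-vanishʳ : ∀ p {r} → r ≋ [] → p *P r ≋ []
*P-vanishʳ p r≋[] = ≋-trans (*P-congˡ p r≋[]) (*P-zeroʳ p)

+P-interchange : ∀ p r u v → (p +P r) +P (u +P v) ≋ (p +P u) +P (r +P v)
+P-interchange p r u v = begin
  (p +P r) +P (u +P v)  ≈⟨ +P-assoc p r (u +P v) ⟩
  p +P (r +P (u +P v))  ≈⟨ +P-cong (≋-refl {p}) (≋-sym (+P-assoc r u v)) ⟩
  p +P ((r +P u) +P v)  ≈⟨ +P-cong (≋-refl {p}) (+P-cong (+P-comm r u) ≋-refl) ⟩
  p +P ((u +P r) +P v)  ≈⟨ +P-cong (≋-refl {p}) (+P-assoc u r v) ⟩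
  p +P (u +P (r +P v))  ≈⟨ ≋-sym (+P-assoc p u (r +P v)) ⟩
  (p +P u) +P (r +P v)  ∎

*P-distribʳ : ∀ p p′ r → (p +P p′) *P r ≋ p *P r +P p′ *P r
*P-distribʳ []      p′       r = ≋-refl
*P-distribʳ (a ∷ p) []       r = ≋-sym (+P-identityʳ _)
*P-distribʳ (a ∷ p) (b ∷ p′) r = begin
  (a ℤ.+ b) ·P r +P (0ℤ ∷ (p +P p′) *P r)
    ≈⟨ +P-cong (·P-distribʳ a b r) (∷-cong refl (*P-distribʳ p p′ r)) ⟩
  (a ·P r +P b ·P r) +P ((0ℤ ∷ p *P r) +P (0ℤ ∷ p′ *P r))
    ≈⟨ +P-interchange (a ·P r) (b ·P r) (0ℤ ∷ p *P r) (0ℤ ∷ p′ *P r) ⟩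
  (a ·P r +P (0ℤ ∷ p *P r)) +P (b ·P r +P (0ℤ ∷ p′ *P r))  ∎

·P-*P-assoc : ∀ a p r → (a ·P p) *P r ≋ a ·P (p *P r)
·P-*P-assoc a []      r = ≋-refl
·P-*P-assoc a (b ∷ p) r = begin
  (a ℤ.* b) ·P r +P (0ℤ ∷ (a ·P p) *P r)
    ≈⟨ +P-cong (≋-sym (·P-assoc a b r)) (∷-cong (≡.sym (ℤ.*-zeroʳ a)) (·P-*P-assoc a p r)) ⟩
  a ·P (b ·P r) +P a ·P (0ℤ ∷ p *P r)     ≈⟨ ≋-sym (·P-distribˡ a (b ·P r) (0ℤ ∷ p *P r)) ⟩
  a ·P (b ·P r +P (0ℤ ∷ p *P r))          ∎

*P-assoc : ∀ p r u → (p *P r) *P u ≋ p *P (r *P u)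
*P-assoc []      r u = ≋-refl
*P-assoc (a ∷ p) r u = begin
  (a ·P r +P (0ℤ ∷ p *P r)) *P u          ≈⟨ *P-distribʳ (a ·P r) (0ℤ ∷ p *P r) u ⟩
  (a ·P r) *P u +P (0ℤ ∷ p *P r) *P u     ≈⟨ +P-cong (·P-*P-assoc a r u) (≋-sym (shift-*P (p *P r))) ⟩
  a ·P (r *P u) +P (0ℤ ∷ (p *P r) *P u)   ≈⟨ +P-cong (≋-refl {a ·P (r *P u)}) (∷-cong refl (*P-assoc p r u)) ⟩
  a ·P (r *P u) +P (0ℤ ∷ p *P (r *P u))   ∎
  where
  shift-*P : ∀ v → 0ℤ ∷ v *P u ≋ (0ℤ ∷ v) *P u
  shift-*P v = ≋-sym (+P-cong (·P-zeroˡ u) ≋-refl)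

*P-∷ʳ : ∀ p b r → p *P (b ∷ r) ≋ b ·P p +P (0ℤ ∷ p *P r)
*P-∷ʳ []      b r = ≋-sym (∷-≋-[] refl ≋-refl)
*P-∷ʳ (a ∷ p) b r = ∷-cong (cong (ℤ._+ 0ℤ) (ℤ.*-comm a b)) (begin
  a ·P r +P p *P (b ∷ r)                ≈⟨ +P-cong (≋-refl {a ·P r}) (*P-∷ʳ p b r) ⟩
  a ·P r +P (b ·P p +P (0ℤ ∷ p *P r))   ≈⟨ ≋-sym (+P-assoc (a ·P r) (b ·P p) _) ⟩
  (a ·P r +P b ·P p) +P (0ℤ ∷ p *P r)   ≈⟨ +P-cong (+P-comm (a ·P r) (b ·P p)) ≋-refl ⟩
  (b ·P p +P a ·P r) +P (0ℤ ∷ p *P r)   ≈⟨ +P-assoc (b ·P p) (a ·P r) _ ⟩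
  b ·P p +P (a ·P r +P (0ℤ ∷ p *P r))   ∎)

*P-comm : ∀ p r → p *P r ≋ r *P p
*P-comm []      r = ≋-sym (*P-zeroʳ r)
*P-comm (a ∷ p) r = ≋-trans (+P-cong ≋-refl (∷-cong refl (*P-comm p r))) (≋-sym (*P-∷ʳ r a p))

*P-identityˡ : ∀ p → oneP *P p ≋ p
*P-identityˡ p = ≋-trans (+P-cong (·P-identityˡ p) (∷-≋-[] refl ≋-refl)) (+P-identityʳ p)

*P-identityʳ : ∀ p → p *P oneP ≋ p
*P-identityʳ p = ≋-trans (*P-comm p oneP) (*P-identityˡ p)

*P-distribˡ : ∀ p r u → p *P (r +P u) ≋ p *P r +P p *P u
*P-distribˡ p r u = begin
  p *P (r +P u)       ≈⟨ *P-comm p (r +P u) ⟩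
  (r +P u) *P p       ≈⟨ *P-distribʳ r u p ⟩
  r *P p +P u *P p    ≈⟨ +P-cong (*P-comm r p) (*P-comm u p) ⟩
  p *P r +P p *P u    ∎

ℤ[q]-isCommutativeRing : IsCommutativeRing _≋_ _+P_ _*P_ -P_ [] oneP
ℤ[q]-isCommutativeRing = record
  { isRing = record
    { +-isAbelianGroup = record
      { isGroup = record
        { isMonoid = record
          { isSemigroup = record
            { isMagma = record { isEquivalence = ≋-isEquivalence ; ∙-cong = +P-cong }
            ; assoc = +P-assoc }
          ; identity = (λ _ → ≋-refl) , +P-identityʳ }
        ; inverse = -P-inverseˡ , -P-inverseʳ
        ; ⁻¹-cong = -P-cong }
      ; comm = +P-comm }
    ; *-cong = *P-cong
    ; *-assoc = *P-assoc
    ; *-identity = *P-identityˡ , *P-identityʳ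
    ; distrib = *P-distribˡ , (λ r p p′ → *P-distribʳ p p′ r) }
  ; *-comm = *P-comm }

ℤ[q] : CommutativeRing _ _
ℤ[q] = record { isCommutativeRing = ℤ[q]-isCommutativeRing }

ℤ[q]-solver : ACR.AlmostCommutativeRing _ _
ℤ[q]-solver = ACR.fromCommutativeRing ℤ[q] ≋[]?
  where
  ≋[]? : ∀ p → Maybe ([] ≋ p)
  ≋[]? []      = just ≋-refl
  ≋[]? (a ∷ p) with a ℤ.≟ 0ℤ | ≋[]? p
  ... | yes a≡0 | just e = just (≋-sym (∷-≋-[] a≡0 (≋-sym e)))
  ... | _       | _      = nothing

open CommutativeRing ℤ[q] using (*-commutativeSemigroup; semiring)
open import Algebra.Properties.Semiring.Divisibility semiring
  using (_,_; ε∣ʳ_; ∣ʳ-refl; ∣ʳ-trans; ∣ʳ-respʳ-≈; ∣ʳ-respˡ-≈) renaming (_∣_ to _∣ₚ_)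
open import Algebra.Properties.CommutativeSemigroup.Divisibility *-commutativeSemigroup
  using (∙-cong-∣; x∣xy; x∣y⇒zx∣zy; x∣ʳy⇒x∣ʳzy)

∣ₚ-+P : ∀ {d p r} → d ∣ₚ p → d ∣ₚ r → d ∣ₚ p +P r
∣ₚ-+P {d} (u , u*d≋p) (v , v*d≋r) = u +P v , ≋-trans (*P-distribʳ u v d) (+P-cong u*d≋p v*d≋r)

∣ₚ-negP : ∀ {d p} → d ∣ₚ p → d ∣ₚ -P p
∣ₚ-negP {d} {p} (u , u*d≋p) = -P u , ≋-trans (-P-*P u d) (-P-cong u*d≋p)
  where
  -P-*P : ∀ x y → (-P x) *P y ≋ -P (x *P y)
  -P-*P = solve-∀ ℤ[q]-solver

∣ₚ-*Pʳ : ∀ {d p} r → d ∣ₚ p → d ∣ₚ p *P r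
∣ₚ-*Pʳ {p = p} r d∣p = ∣ʳ-trans d∣p (x∣xy p r)

∣ₚ⇒∣P : ∀ {d p} → d ∣ₚ p → d ∣P p
∣ₚ⇒∣P {d} (u , u*d≋p) = u , coeff-≡ (≋-sym (≋-trans (*P-comm d u) u*d≋p))

^P-∣ₚ-mono : ∀ p {a b} → a ≤ b → p ^P a ∣ₚ p ^P b
^P-∣ₚ-mono p {b = b} z≤n     = ε∣ʳ (p ^P b)
^P-∣ₚ-mono p         (s≤s a≤b) = x∣y⇒zx∣zy p (^P-∣ₚ-mono p a≤b)

-- The polynomials 1 - q^k

X^-+ : ∀ a b → X^ a *P X^ b ≋ X^ (a + b)
X^-+ zero    b = *P-identityˡ (X^ b)
X^-+ (suc a) b = ≋-trans (+P-cong (·P-zeroˡ (X^ b)) ≋-refl) (∷-cong refl (X^-+ a b))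

1-q^ : ℕ → Poly
1-q^ k = oneP -P X^ k

1+q^ : ℕ → Poly
1+q^ k = oneP +P X^ k

1-q^0 : 1-q^ 0 ≋ []
1-q^0 = -P-inverseʳ oneP

1-q^-+ : ∀ a b → 1-q^ a +P X^ a *P 1-q^ b ≋ 1-q^ (a + b)
1-q^-+ a b = begin
  1-q^ a +P X^ a *P 1-q^ b  ≈⟨ telescope (X^ a) (X^ b) ⟩
  oneP -P X^ a *P X^ b      ≈⟨ +P-cong (≋-refl {oneP}) (-P-cong (X^-+ a b)) ⟩
  1-q^ (a + b)              ∎
  where
  telescope : ∀ x y → (oneP -P x) +P x *P (oneP -P y) ≋ oneP -P x *P y
  telescope = solve-∀ ℤ[q]-solver

geomSum : ℕ → List ℕ → Poly
geomSum t = foldr (λ j acc → X^ (j * t) +P acc) []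

geomSum-map-suc : ∀ t js → geomSum t (map suc js) ≋ X^ t *P geomSum t js
geomSum-map-suc t []       = ≋-sym (*P-zeroʳ (X^ t))
geomSum-map-suc t (j ∷ js) = begin
  X^ (t + j * t) +P geomSum t (map suc js)     ≈⟨ +P-cong (≋-sym (X^-+ t (j * t))) (geomSum-map-suc t js) ⟩
  X^ t *P X^ (j * t) +P X^ t *P geomSum t js   ≈⟨ ≋-sym (*P-distribˡ (X^ t) (X^ (j * t)) (geomSum t js)) ⟩
  X^ t *P (X^ (j * t) +P geomSum t js)         ∎

qintAt-suc : ∀ k t → qintAt (suc k) t ≋ oneP +P X^ t *P qintAt k t
qintAt-suc k t = begin
  oneP +P geomSum t (applyUpTo suc k)   ≡⟨ cong (λ js → oneP +P geomSum t js) (≡.sym (map-applyUpTo id suc k)) ⟩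
  oneP +P geomSum t (map suc (upTo k))  ≈⟨ +P-cong (≋-refl {oneP}) (geomSum-map-suc t (upTo k)) ⟩
  oneP +P X^ t *P qintAt k t            ∎

1-q^*qintAt : ∀ k t → 1-q^ t *P qintAt k t ≋ 1-q^ (k * t)
1-q^*qintAt zero    t = ≋-trans (*P-zeroʳ (1-q^ t)) (≋-sym 1-q^0)
1-q^*qintAt (suc k) t = begin
  1-q^ t *P qintAt (suc k) t                   ≈⟨ *P-congˡ (1-q^ t) (qintAt-suc k t) ⟩
  1-q^ t *P (oneP +P X^ t *P qintAt k t)       ≈⟨ expand (1-q^ t) (X^ t) (qintAt k t) ⟩
  1-q^ t +P X^ t *P (1-q^ t *P qintAt k t)     ≈⟨ +P-cong (≋-refl {1-q^ t}) (*P-congˡ (X^ t) (1-q^*qintAt k t)) ⟩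
  1-q^ t +P X^ t *P 1-q^ (k * t)               ≈⟨ 1-q^-+ t (k * t) ⟩
  1-q^ (suc k * t)                             ∎
  where
  expand : ∀ c x y → c *P (oneP +P x *P y) ≋ c +P x *P (c *P y)
  expand = solve-∀ ℤ[q]-solver

1-q^-∣ : ∀ {a b} → a ∣ b → 1-q^ a ∣ₚ 1-q^ b
1-q^-∣ {a} (divides r refl) = qintAt r a , ≋-trans (*P-comm (qintAt r a) (1-q^ a)) (1-q^*qintAt r a)

coeff-X^*P-+ : ∀ k p i → coeff (X^ k *P p) (k + i) ≡ coeff p i
coeff-X^*P-+ zero    p i = coeff-≡ (*P-identityˡ p) i
coeff-X^*P-+ (suc k) p i = ≡.trans (coeff-≡ (+P-cong (·P-zeroˡ p) ≋-refl) (suc (k + i))) (coeff-X^*P-+ k p i)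

coeff-X^*P-< : ∀ k p {i} → i < k → coeff (X^ k *P p) i ≡ 0ℤ
coeff-X^*P-< (suc k) p {zero}  _         = coeff-≡ (+P-cong (·P-zeroˡ p) ≋-refl) zero
coeff-X^*P-< (suc k) p {suc i} (s≤s i<k) =
  ≡.trans (coeff-≡ (+P-cong (·P-zeroˡ p) ≋-refl) (suc i)) (coeff-X^*P-< k p i<k)

X^-fixed⇒≋[] : ∀ {k p} → 1 ≤ k → p ≋ X^ k *P p → p ≋ []
X^-fixed⇒≋[] {k} {p} 1≤k p≋X^p = mk≋ λ i → vanish i (<-wellFounded i)
  where
  vanish : ∀ i → Acc _<_ i → coeff p i ≡ 0ℤ
  vanish i (acc rec) with i ℕ.<? k
  ... | yes i<k = ≡.trans (coeff-≡ p≋X^p i) (coeff-X^*P-< k p i<k)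
  ... | no  i≮k =
    ≡.trans (cong (coeff p) (≡.sym k+j≡i))
      (≡.trans (coeff-≡ p≋X^p (k + j)) (≡.trans (coeff-X^*P-+ k p j) (vanish j (rec j<i))))
    where
    j = i ∸ k
    k+j≡i : k + j ≡ i
    k+j≡i = ℕ.m+[n∸m]≡n (ℕ.≮⇒≥ i≮k)
    j<i : j < i
    j<i = ℕ.<-≤-trans (ℕ.m<n+m j 1≤k) (ℕ.≤-reflexive k+j≡i)

1-q^-cancelˡ : ∀ {k p r} → 1 ≤ k → 1-q^ k *P p ≋ 1-q^ k *P r → p ≋ r
1-q^-cancelˡ {k} {p} {r} 1≤k eq = begin
  p               ≈⟨ split p r ⟩
  r +P (p -P r)   ≈⟨ +P-cong (≋-refl {r}) (X^-fixed⇒≋[] 1≤k fixed) ⟩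
  r +P []         ≈⟨ +P-identityʳ r ⟩
  r               ∎
  where
  split : ∀ x y → x ≋ y +P (x -P y)
  split = solve-∀ ℤ[q]-solver
  z = p -P r
  killed : 1-q^ k *P z ≋ []
  killed = begin
    1-q^ k *P (p -P r)              ≈⟨ *P-distrib-P (1-q^ k) p r ⟩
    1-q^ k *P p -P 1-q^ k *P r      ≈⟨ +P-cong eq ≋-refl ⟩
    1-q^ k *P r -P 1-q^ k *P r      ≈⟨ -P-inverseʳ (1-q^ k *P r) ⟩
    []                              ∎
    where
    *P-distrib-P : ∀ x y w → x *P (y -P w) ≋ x *P y -P x *P w
    *P-distrib-P = solve-∀ ℤ[q]-solver
  fixed : z ≋ X^ k *P z
  fixed = begin
    z                           ≈⟨ decompose (X^ k) z ⟩
    X^ k *P z +P 1-q^ k *P z    ≈⟨ +P-cong (≋-refl {X^ k *P z}) killed ⟩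
    X^ k *P z +P []             ≈⟨ +P-identityʳ (X^ k *P z) ⟩
    X^ k *P z                   ∎
    where
    decompose : ∀ x w → w ≋ x *P w +P (oneP -P x) *P w
    decompose = solve-∀ ℤ[q]-solver

1-q^-cancel-∣ₚ : ∀ {k p r} → 1 ≤ k → 1-q^ k *P p ∣ₚ 1-q^ k *P r → p ∣ₚ r
1-q^-cancel-∣ₚ {k} {p} {r} 1≤k (u , u*[1-q^k*p]≋1-q^k*r) =
  u , 1-q^-cancelˡ 1≤k (≋-trans (*P-swap (1-q^ k) u p) u*[1-q^k*p]≋1-q^k*r)
  where
  *P-swap : ∀ x y w → x *P (y *P w) ≋ y *P (x *P w)
  *P-swap = solve-∀ ℤ[q]-solver

∣ₚ-1-q^-+ : ∀ {D B a b c} → a + b ≡ c → D ∣ₚ 1-q^ c *P B → D ∣ₚ 1-q^ b *P B → D ∣ₚ 1-q^ a *P B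
∣ₚ-1-q^-+ {D} {B} {a} {b} refl D∣[1-q^c]B D∣[1-q^b]B =
  ∣ʳ-respʳ-≈ (≋-sym (begin
    1-q^ a *P B                                       ≈⟨ *P-congʳ B (≋-sym (isolate (1-q^ a) (X^ a *P 1-q^ b))) ⟩
    (1-q^ a +P X^ a *P 1-q^ b -P X^ a *P 1-q^ b) *P B ≈⟨ *P-congʳ B (+P-cong (1-q^-+ a b) ≋-refl) ⟩
    (1-q^ (a + b) -P X^ a *P 1-q^ b) *P B             ≈⟨ regroup (1-q^ (a + b)) (X^ a) (1-q^ b) B ⟩
    1-q^ (a + b) *P B -P (1-q^ b *P B) *P X^ a        ∎))
  (∣ₚ-+P D∣[1-q^c]B (∣ₚ-negP (∣ₚ-*Pʳ (X^ a) D∣[1-q^b]B)))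
  where
  isolate : ∀ x y → x +P y -P y ≋ x
  isolate = solve-∀ ℤ[q]-solver
  regroup : ∀ u x v w → (u -P x *P v) *P w ≋ u *P w -P (v *P w) *P x
  regroup = solve-∀ ℤ[q]-solver

1-q^-gcd : ∀ {N n B} → 1-q^ N ∣ₚ 1-q^ n *P B → 1-q^ N ∣ₚ 1-q^ (gcd N n) *P B
1-q^-gcd {N} {n} {B} 1-q^N∣[1-q^n]B = from-identity (Bézout.identity (gcd-GCD N n))
  where
  multiple-of-N : ∀ x → 1-q^ N ∣ₚ 1-q^ (x * N) *P B
  multiple-of-N x = ∣ₚ-*Pʳ B (1-q^-∣ (divides x refl))
  multiple-of-n : ∀ y → 1-q^ N ∣ₚ 1-q^ (y * n) *P B
  multiple-of-n y = ∣ʳ-trans 1-q^N∣[1-q^n]B (∙-cong-∣ (1-q^-∣ (divides y refl)) (∣ʳ-refl {B}))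
  from-identity : ∀ {d} → Bézout.Identity d N n → 1-q^ N ∣ₚ 1-q^ d *P B
  from-identity {d} (Bézout.+- x y eq) = ∣ₚ-1-q^-+ {a = d} {b = y * n} eq (multiple-of-N x) (multiple-of-n y)
  from-identity {d} (Bézout.-+ x y eq) = ∣ₚ-1-q^-+ {a = d} {b = x * N} eq (multiple-of-n y) (multiple-of-N x)

-- q-binomial coefficients

qbinom-vanish : ∀ {n k} → n < k → qbinom n k ≋ []
qbinom-vanish {zero}  {suc k} _         = ≋-refl
qbinom-vanish {suc n} {suc k} (s≤s n<k) = +P-cong (qbinom-vanish n<k)
  (≋-trans (*P-congˡ (X^ (suc k)) (qbinom-vanish (ℕ.m<n⇒m<1+n n<k))) (*P-zeroʳ (X^ (suc k))))

qbinom-pascal-*P : ∀ c n k → c *P qbinom (suc n) (suc k) ≋ c *P qbinom n k +P X^ (suc k) *P (c *P qbinom n (suc k))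
qbinom-pascal-*P c n k = distrib c (qbinom n k) (X^ (suc k)) (qbinom n (suc k))
  where
  distrib : ∀ c b₀ x b₁ → c *P (b₀ +P x *P b₁) ≋ c *P b₀ +P x *P (c *P b₁)
  distrib = solve-∀ ℤ[q]-solver

1-q^-telescope : ∀ {k n} → k ≤ n → ∀ p → 1-q^ (suc k) *P p +P X^ (suc k) *P (1-q^ (n ∸ k) *P p) ≋ 1-q^ (suc n) *P p
1-q^-telescope {k} {n} k≤n p = begin
  1-q^ (suc k) *P p +P X^ (suc k) *P (1-q^ (n ∸ k) *P p)  ≈⟨ factor (1-q^ (suc k)) (X^ (suc k)) (1-q^ (n ∸ k)) p ⟩
  (1-q^ (suc k) +P X^ (suc k) *P 1-q^ (n ∸ k)) *P p       ≈⟨ *P-congʳ p (1-q^-+ (suc k) (n ∸ k)) ⟩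
  1-q^ (suc k + (n ∸ k)) *P p                             ≡⟨ cong (λ e → 1-q^ (suc e) *P p) (ℕ.m+[n∸m]≡n k≤n) ⟩
  1-q^ (suc n) *P p                                       ∎
  where
  factor : ∀ a x b w → a *P w +P x *P (b *P w) ≋ (a +P x *P b) *P w
  factor = solve-∀ ℤ[q]-solver

mutual
  qbinom-absorb : ∀ n k → 1-q^ (suc k) *P qbinom (suc n) (suc k) ≋ 1-q^ (suc n) *P qbinom n k
  qbinom-absorb n k with k ℕ.≤? n
  ... | yes k≤n = begin
    1-q^ (suc k) *P qbinom (suc n) (suc k)
      ≈⟨ qbinom-pascal-*P (1-q^ (suc k)) n k ⟩
    1-q^ (suc k) *P qbinom n k +P X^ (suc k) *P (1-q^ (suc k) *P qbinom n (suc k))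
      ≈⟨ +P-cong (≋-refl {1-q^ (suc k) *P qbinom n k}) (*P-congˡ (X^ (suc k)) (qbinom-ratio n k)) ⟩
    1-q^ (suc k) *P qbinom n k +P X^ (suc k) *P (1-q^ (n ∸ k) *P qbinom n k)
      ≈⟨ 1-q^-telescope k≤n (qbinom n k) ⟩
    1-q^ (suc n) *P qbinom n k  ∎
  ... | no k≰n = ≋-trans (*P-vanishʳ (1-q^ (suc k)) (qbinom-vanish (s≤s (ℕ.≰⇒> k≰n))))
                         (≋-sym (*P-vanishʳ (1-q^ (suc n)) (qbinom-vanish (ℕ.≰⇒> k≰n))))

  qbinom-absorb-dual : ∀ n k → 1-q^ (n ∸ k) *P qbinom (suc n) (suc k) ≋ 1-q^ (suc n) *P qbinom n (suc k)
  qbinom-absorb-dual n k with k ℕ.≤? n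
  ... | yes k≤n = begin
    1-q^ (n ∸ k) *P qbinom (suc n) (suc k)
      ≈⟨ qbinom-pascal-*P (1-q^ (n ∸ k)) n k ⟩
    1-q^ (n ∸ k) *P qbinom n k +P X^ (suc k) *P (1-q^ (n ∸ k) *P qbinom n (suc k))
      ≈⟨ +P-cong (≋-sym (qbinom-ratio n k)) ≋-refl ⟩
    1-q^ (suc k) *P qbinom n (suc k) +P X^ (suc k) *P (1-q^ (n ∸ k) *P qbinom n (suc k))
      ≈⟨ 1-q^-telescope k≤n (qbinom n (suc k)) ⟩
    1-q^ (suc n) *P qbinom n (suc k)  ∎
  ... | no k≰n = ≋-trans (*P-vanishˡ (qbinom (suc n) (suc k)) 1-q^[n∸k]≋[])
                         (≋-sym (*P-vanishʳ (1-q^ (suc n)) (qbinom-vanish (s≤s (ℕ.<⇒≤ (ℕ.≰⇒> k≰n))))))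
    where
    1-q^[n∸k]≋[] : 1-q^ (n ∸ k) ≋ []
    1-q^[n∸k]≋[] = ≋-trans (≋-reflexive (cong 1-q^ (ℕ.m≤n⇒m∸n≡0 (ℕ.<⇒≤ (ℕ.≰⇒> k≰n))))) 1-q^0

  qbinom-ratio : ∀ n k → 1-q^ (suc k) *P qbinom n (suc k) ≋ 1-q^ (n ∸ k) *P qbinom n k
  qbinom-ratio zero    k       = ≋-trans (*P-zeroʳ (1-q^ (suc k)))
    (≋-sym (*P-vanishˡ (qbinom 0 k) (≋-trans (≋-reflexive (cong 1-q^ (ℕ.0∸n≡0 k))) 1-q^0)))
  qbinom-ratio (suc n) zero    = qbinom-absorb n zero
  qbinom-ratio (suc n) (suc k) = ≋-trans (qbinom-absorb n (suc k)) (≋-sym (qbinom-absorb-dual n k))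

1-q^N∣1-q^n*qbinom : ∀ {N n} → 1 ≤ N → 1 ≤ n → 1-q^ N ∣ₚ 1-q^ n *P qbinom N n
1-q^N∣1-q^n*qbinom {suc M} {suc k} _ _ =
  qbinom M k , ≋-trans (*P-comm (qbinom M k) (1-q^ (suc M))) (≋-sym (qbinom-absorb M k))

-- The products ∏_{i<c} (1 + q^(2^i g))

2^[1+c]*g≡2^c*g+2^c*g : ∀ c g → 2 ^ suc c * g ≡ 2 ^ c * g + 2 ^ c * g
2^[1+c]*g≡2^c*g+2^c*g c g = ≡.trans (ℕ.*-assoc 2 (2 ^ c) g) (cong (2 ^ c * g +_) (ℕ.+-identityʳ (2 ^ c * g)))

2^c*g<2^[1+c]*g : ∀ c {g} → 1 ≤ g → 2 ^ c * g < 2 ^ suc c * g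
2^c*g<2^[1+c]*g c {g} 1≤g = ℕ.<-≤-trans (ℕ.m<m+n (2 ^ c * g) (ℕ.*-mono-≤ (ℕ.m^n>0 2 c) 1≤g))
                                       (ℕ.≤-reflexive (≡.sym (2^[1+c]*g≡2^c*g+2^c*g c g)))

chainProd : ℕ → ℕ → Poly
chainProd g zero    = oneP
chainProd g (suc c) = 1+q^ (2 ^ c * g) *P chainProd g c

1-q^*chainProd : ∀ g c → 1-q^ g *P chainProd g c ≋ 1-q^ (2 ^ c * g)
1-q^*chainProd g zero    = ≋-trans (*P-identityʳ (1-q^ g)) (≋-reflexive (cong 1-q^ (≡.sym (ℕ.*-identityˡ g))))
1-q^*chainProd g (suc c) = begin
  1-q^ g *P (1+q^ e *P chainProd g c)   ≈⟨ swap (1-q^ g) (1+q^ e) (chainProd g c) ⟩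
  1+q^ e *P (1-q^ g *P chainProd g c)   ≈⟨ *P-congˡ (1+q^ e) (1-q^*chainProd g c) ⟩
  1+q^ e *P 1-q^ e                      ≈⟨ squares (X^ e) ⟩
  oneP -P X^ e *P X^ e                  ≈⟨ +P-cong (≋-refl {oneP}) (-P-cong (X^-+ e e)) ⟩
  1-q^ (e + e)                          ≡⟨ cong 1-q^ (≡.sym (2^[1+c]*g≡2^c*g+2^c*g c g)) ⟩
  1-q^ (2 ^ suc c * g)                  ∎
  where
  e = 2 ^ c * g
  swap : ∀ x y w → x *P (y *P w) ≋ y *P (x *P w)
  swap = solve-∀ ℤ[q]-solver
  squares : ∀ x → (oneP +P x) *P (oneP -P x) ≋ oneP -P x *P x
  squares = solve-∀ ℤ[q]-solver

qintAt∣chainProd*qbinom : ∀ a t {n g c} → 1 ≤ a * t → 1 ≤ n → 1 ≤ g → g ∣ t → 2 ^ c * g ≡ gcd (a * t) n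
  → qintAt a t ∣ₚ chainProd g c *P qbinom (a * t) n
qintAt∣chainProd*qbinom a t {n} {g} {c} 1≤N 1≤n 1≤g g∣t 2^c*g≡gcd =
  1-q^-cancel-∣ₚ 1≤g (∣ʳ-trans [1-q^g]A∣1-q^N 1-q^N∣[1-q^g]PB)
  where
  N = a * t
  B = qbinom N n
  [1-q^g]A∣1-q^N : 1-q^ g *P qintAt a t ∣ₚ 1-q^ N
  [1-q^g]A∣1-q^N = ∣ʳ-respʳ-≈ (1-q^*qintAt a t) (∙-cong-∣ (1-q^-∣ g∣t) (∣ʳ-refl {qintAt a t}))
  1-q^N∣[1-q^g]PB : 1-q^ N ∣ₚ 1-q^ g *P (chainProd g c *P B)
  1-q^N∣[1-q^g]PB = ∣ʳ-respʳ-≈ (begin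
    1-q^ (gcd N n) *P B                ≡⟨ cong (λ d → 1-q^ d *P B) (≡.sym 2^c*g≡gcd) ⟩
    1-q^ (2 ^ c * g) *P B              ≈⟨ *P-congʳ B (≋-sym (1-q^*chainProd g c)) ⟩
    (1-q^ g *P chainProd g c) *P B     ≈⟨ *P-assoc (1-q^ g) (chainProd g c) B ⟩
    1-q^ g *P (chainProd g c *P B)     ∎)
    (1-q^-gcd {N} {n} {B} (1-q^N∣1-q^n*qbinom 1≤N 1≤n))

-- Factoring (-q;q)_m

negQPochWithout : (ℕ → Bool) → ℕ → Poly
negQPochWithout skip zero    = oneP
negQPochWithout skip (suc m) = negQPochWithout skip m *P (if skip (suc m) then oneP else 1+q^ (suc m))

negQPoch≡negQPochWithout-∅ : ∀ m → negQPoch m ≡ negQPochWithout (λ _ → false) m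
negQPoch≡negQPochWithout-∅ zero    = refl
negQPoch≡negQPochWithout-∅ (suc m) = cong (_*P 1+q^ (suc m)) (negQPoch≡negQPochWithout-∅ m)

negQPochWithout-cong : ∀ {skip skip′} m → (∀ {j} → j ≤ m → skip j ≡ skip′ j) →
                       negQPochWithout skip m ≡ negQPochWithout skip′ m
negQPochWithout-cong zero    agree = refl
negQPochWithout-cong (suc m) agree = cong₂ (λ W b → W *P (if b then oneP else 1+q^ (suc m)))
  (negQPochWithout-cong m (agree ∘ ℕ.m≤n⇒m≤1+n)) (agree ℕ.≤-refl)

negQPochWithout-insert : ∀ {skip skip′ j} m → skip j ≡ false → skip′ j ≡ true → (∀ {i} → i ≢ j → skip′ i ≡ skip i) →
                         1 ≤ j → j ≤ m → negQPochWithout skip m ≋ 1+q^ j *P negQPochWithout skip′ m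
negQPochWithout-insert zero    _ _ _ (s≤s _) ()
negQPochWithout-insert {skip} {skip′} {j} (suc m) skip[j] skip′[j] elsewhere 1≤j j≤1+m
  with ℕ.m≤n⇒m<n∨m≡n j≤1+m
... | inj₂ refl = begin
  negQPochWithout skip m *P (if skip j then oneP else 1+q^ j)
    ≡⟨ cong₂ (λ W b → W *P (if b then oneP else 1+q^ j)) (negQPochWithout-cong m below) skip[j] ⟩
  negQPochWithout skip′ m *P 1+q^ j                                 ≈⟨ *P-comm (negQPochWithout skip′ m) (1+q^ j) ⟩
  1+q^ j *P negQPochWithout skip′ m                                 ≈⟨ *P-congˡ (1+q^ j) (≋-sym (*P-identityʳ _)) ⟩
  1+q^ j *P (negQPochWithout skip′ m *P oneP)
    ≡⟨ cong (λ b → 1+q^ j *P (negQPochWithout skip′ m *P (if b then oneP else 1+q^ j))) (≡.sym skip′[j]) ⟩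
  1+q^ j *P (negQPochWithout skip′ m *P (if skip′ j then oneP else 1+q^ j))  ∎
  where
  below : ∀ {i} → i ≤ m → skip i ≡ skip′ i
  below i≤m = ≡.sym (elsewhere (ℕ.<⇒≢ (s≤s i≤m)))
... | inj₁ (s≤s j≤m) = begin
  negQPochWithout skip m *P f (skip (suc m))
    ≈⟨ *P-congʳ _ (negQPochWithout-insert m skip[j] skip′[j] elsewhere 1≤j j≤m) ⟩
  (1+q^ j *P negQPochWithout skip′ m) *P f (skip (suc m))
    ≡⟨ cong (λ b → (1+q^ j *P negQPochWithout skip′ m) *P f b) (≡.sym (elsewhere (ℕ.<⇒≢ (s≤s j≤m) ∘ ≡.sym))) ⟩
  (1+q^ j *P negQPochWithout skip′ m) *P f (skip′ (suc m))
    ≈⟨ *P-assoc (1+q^ j) _ _ ⟩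
  1+q^ j *P (negQPochWithout skip′ m *P f (skip′ (suc m)))  ∎
  where
  f : Bool → Poly
  f b = if b then oneP else 1+q^ (suc m)

odd : ℕ → Bool
odd zero    = false
odd (suc n) = not (odd n)

odd-2* : ∀ n → odd (2 * n) ≡ false
odd-2* zero    = refl
odd-2* (suc n) = ≡.trans (cong odd (ℕ.*-suc 2 n)) (≡.trans (not-involutive (odd (2 * n))) (odd-2* n))

inChain : ℕ → ℕ → ℕ → Bool
inChain g zero    j = false
inChain g (suc c) j = does (j ℕ.≟ 2 ^ c * g) ∨ inChain g c j

inChain-suc : ∀ {g} c {j} → inChain g (suc c) j ≡ true → j ≡ 2 ^ c * g ⊎ inChain g c j ≡ true
inChain-suc {g} c {j} = split (j ℕ.≟ 2 ^ c * g)
  where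
  split : ∀ {b} → (j≟e : Dec (j ≡ 2 ^ c * g)) → does j≟e ∨ b ≡ true → j ≡ 2 ^ c * g ⊎ b ≡ true
  split (yes j≡e) _   = inj₁ j≡e
  split (no  _)   b≡t = inj₂ b≡t

inChain-< : ∀ {g} c {j} → 1 ≤ g → inChain g c j ≡ true → j < 2 ^ c * g
inChain-< zero    _   ()
inChain-< (suc c) 1≤g j∈chain with inChain-suc c j∈chain
... | inj₁ refl     = 2^c*g<2^[1+c]*g c 1≤g
... | inj₂ j∈chain′ = ℕ.<-trans (inChain-< c 1≤g j∈chain′) (2^c*g<2^[1+c]*g c 1≤g)

inChain-odd : ∀ {g} c {j} → odd j ∧ inChain g c j ≡ true → j ≡ g
inChain-odd zero    {j} odd-j∈chain with () ← ∧-conicalʳ (odd j) false odd-j∈chain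
inChain-odd {g} (suc c) {j} odd-j∈chain with inChain-suc c (∧-conicalʳ (odd j) _ odd-j∈chain)
inChain-odd {g} (suc zero)    odd-j∈chain | inj₁ refl = ℕ.*-identityˡ g
inChain-odd {g} (suc (suc c)) odd-j∈chain | inj₁ refl with () ← ≡.trans (≡.sym (∧-conicalˡ _ _ odd-j∈chain))
  (≡.trans (cong odd (ℕ.*-assoc 2 (2 ^ c) g)) (odd-2* (2 ^ c * g)))
inChain-odd {g} (suc c) {j} odd-j∈chain | inj₂ j∈chain =
  inChain-odd c (cong₂ _∧_ (∧-conicalˡ _ _ odd-j∈chain) j∈chain)

negQPoch-chainProd : ∀ {g} c m → 1 ≤ g → 2 ^ c * g ≤ 2 * m →
                     negQPoch m ≋ chainProd g c *P negQPochWithout (inChain g c) m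
negQPoch-chainProd zero    m _ _ = ≋-trans (≋-reflexive (negQPoch≡negQPochWithout-∅ m)) (≋-sym (*P-identityˡ _))
negQPoch-chainProd {g} (suc c) m 1≤g 2^[1+c]*g≤2m = begin
  negQPoch m
    ≈⟨ negQPoch-chainProd c m 1≤g (ℕ.<⇒≤ (ℕ.<-≤-trans (2^c*g<2^[1+c]*g c 1≤g) 2^[1+c]*g≤2m)) ⟩
  chainProd g c *P negQPochWithout (inChain g c) m
    ≈⟨ *P-congˡ (chainProd g c) (negQPochWithout-insert m e∉chain e∈chain′ elsewhere 1≤e e≤m) ⟩
  chainProd g c *P (1+q^ e *P negQPochWithout (inChain g (suc c)) m)
    ≈⟨ swap (chainProd g c) (1+q^ e) _ ⟩
  (1+q^ e *P chainProd g c) *P negQPochWithout (inChain g (suc c)) m  ∎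
  where
  e = 2 ^ c * g
  1≤e : 1 ≤ e
  1≤e = ℕ.*-mono-≤ (ℕ.m^n>0 2 c) 1≤g
  e≤m : e ≤ m
  e≤m = ℕ.*-cancelˡ-≤ 2 (ℕ.≤-trans (ℕ.≤-reflexive (≡.sym (ℕ.*-assoc 2 (2 ^ c) g))) 2^[1+c]*g≤2m)
  e∉chain : inChain g c e ≡ false
  e∉chain = ¬-not λ e∈chain → ℕ.<-irrefl refl (inChain-< c 1≤g e∈chain)
  e∈chain′ : inChain g (suc c) e ≡ true
  e∈chain′ = cong (_∨ inChain g c e) (dec-true (e ℕ.≟ e) refl)
  elsewhere : ∀ {i} → i ≢ e → inChain g (suc c) i ≡ inChain g c i
  elsewhere {i} i≢e = cong (_∨ inChain g c i) (dec-false (i ℕ.≟ e) i≢e)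
  swap : ∀ x y w → x *P (y *P w) ≋ (y *P x) *P w
  swap = solve-∀ ℤ[q]-solver

1+q∣1+q^odd : ∀ n → odd n ≡ true → 1+q^ 1 ∣ₚ 1+q^ n
1+q∣1+q^odd (suc zero)    _   = ∣ʳ-refl
1+q∣1+q^odd (suc (suc n)) odd[2+n] = ∣ʳ-respʳ-≈ (≋-sym decompose)
  (∣ₚ-+P (x∣ʳy⇒x∣ʳzy (X^ 1 *P X^ 1) (1+q∣1+q^odd n odd[n])) (x∣xy (1+q^ 1) (1-q^ 1)))
  where
  odd[n] : odd n ≡ true
  odd[n] = ≡.trans (≡.sym (not-involutive (odd n))) odd[2+n]
  identity : ∀ x y → oneP +P x *P (x *P y) ≋ (x *P x) *P (oneP +P y) +P (oneP +P x) *P (oneP -P x)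
  identity = solve-∀ ℤ[q]-solver
  decompose : 1+q^ (suc (suc n)) ≋ (X^ 1 *P X^ 1) *P 1+q^ n +P 1+q^ 1 *P 1-q^ 1
  decompose = begin
    oneP +P X^ (1 + (1 + n))
      ≈⟨ +P-cong (≋-refl {oneP}) (≋-sym (≋-trans (*P-congˡ (X^ 1) (X^-+ 1 n)) (X^-+ 1 (1 + n)))) ⟩
    oneP +P X^ 1 *P (X^ 1 *P X^ n)
      ≈⟨ identity (X^ 1) (X^ n) ⟩
    (X^ 1 *P X^ 1) *P 1+q^ n +P 1+q^ 1 *P 1-q^ 1  ∎

count : (ℕ → Bool) → ℕ → ℕ
count p zero    = 0
count p (suc m) = if p (suc m) then suc (count p m) else count p m

[1+q]^count∣negQPochWithout : ∀ skip m → (1+q^ 1) ^P count (λ j → odd j ∧ not (skip j)) m ∣ₚ negQPochWithout skip m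
[1+q]^count∣negQPochWithout skip zero    = ∣ʳ-refl
[1+q]^count∣negQPochWithout skip (suc m) = step (skip (suc m)) (odd (suc m)) refl ([1+q]^count∣negQPochWithout skip m)
  where
  step : ∀ b o {c W} → odd (suc m) ≡ o → (1+q^ 1) ^P c ∣ₚ W →
         (1+q^ 1) ^P (if o ∧ not b then suc c else c) ∣ₚ W *P (if b then oneP else 1+q^ (suc m))
  step true  true  _ d = ∣ₚ-*Pʳ oneP d
  step true  false _ d = ∣ₚ-*Pʳ oneP d
  step false false _ d = ∣ₚ-*Pʳ (1+q^ (suc m)) d
  step false true {c} odd[m] d =
    ∣ʳ-respˡ-≈ (*P-comm ((1+q^ 1) ^P c) (1+q^ 1)) (∙-cong-∣ d (1+q∣1+q^odd (suc m) odd[m]))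

count-split : ∀ (p r : ℕ → Bool) m → count p m ≡ count (λ j → p j ∧ r j) m + count (λ j → p j ∧ not (r j)) m
count-split p r zero    = refl
count-split p r (suc m) = step (p (suc m)) (r (suc m)) (count-split p r m)
  where
  step : ∀ a b {x y z} → x ≡ y + z →
         (if a then suc x else x) ≡ (if a ∧ b then suc y else y) + (if a ∧ not b then suc z else z)
  step true  true  x≡y+z         = cong suc x≡y+z
  step true  false {y = y} {z} x≡y+z = ≡.trans (cong suc x≡y+z) (≡.sym (ℕ.+-suc y z))
  step false b     x≡y+z         = x≡y+z

count-≡0 : ∀ p m → (∀ {j} → j ≤ m → p j ≡ false) → count p m ≡ 0
count-≡0 p zero    _    = refl
count-≡0 p (suc m) none = step (p (suc m)) (none ℕ.≤-refl) (count-≡0 p m (none ∘ ℕ.m≤n⇒m≤1+n))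
  where
  step : ∀ b {x} → b ≡ false → x ≡ 0 → (if b then suc x else x) ≡ 0
  step false _ x≡0 = x≡0

count-≤1 : ∀ p {g} m → (∀ {j} → p j ≡ true → j ≡ g) → count p m ≤ 1
count-≤1 p zero    _      = z≤n
count-≤1 p (suc m) only-g = step (p (suc m)) refl
  where
  step : ∀ b → p (suc m) ≡ b → (if b then suc (count p m) else count p m) ≤ 1
  step true  p[1+m] = ℕ.≤-reflexive (cong suc (count-≡0 p m λ {j} j≤m → ¬-not λ p[j] →
    ℕ.<⇒≢ (s≤s j≤m) (≡.trans (only-g p[j]) (≡.sym (only-g p[1+m])))))
  step false _      = count-≤1 p m only-g

count-odd : ∀ m → count odd (suc m) ≡ suc (m / 2)
count-odd zero          = refl
count-odd (suc zero)    = refl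
count-odd (suc (suc m)) = ≡.trans (two-more (odd (suc m)) {count odd (suc m)})
  (cong suc (≡.trans (count-odd m) (≡.sym (m/n≡1+[m∸n]/n {suc (suc m)} {2} (s≤s (s≤s z≤n))))))
  where
  two-more : ∀ b {x} → let y = if not b then suc x else x in (if not (not b) then suc y else y) ≡ suc x
  two-more true  = refl
  two-more false = refl

-- There are m/2 + 1 odd j ≤ m + 1, and at most one of them is skipped.
half≤count-odd-unskipped : ∀ skip {g} m → (∀ {j} → odd j ∧ skip j ≡ true → j ≡ g) →
                           m / 2 ≤ count (λ j → odd j ∧ not (skip j)) (suc m)
half≤count-odd-unskipped skip m one-odd-skipped = ℕ.≤-pred (ℕ.≤-trans
  (ℕ.≤-reflexive (≡.trans (≡.sym (count-odd m)) (count-split odd skip (suc m))))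
  (ℕ.+-monoˡ-≤ _ (count-≤1 (λ j → odd j ∧ skip j) (suc m) one-odd-skipped)))

[1+q]^[m/2]∣negQPochWithout : ∀ skip {g} m → (∀ {j} → odd j ∧ skip j ≡ true → j ≡ g) →
                               (1+q^ 1) ^P (m / 2) ∣ₚ negQPochWithout skip (suc m)
[1+q]^[m/2]∣negQPochWithout skip m one-odd-skipped =
  ∣ʳ-trans (^P-∣ₚ-mono (1+q^ 1) (half≤count-odd-unskipped skip m one-odd-skipped))
           ([1+q]^count∣negQPochWithout skip (suc m))

-- Odd parts

even-or-odd : ∀ n → (∃ λ h → n ≡ 2 * h) ⊎ (∃ λ h → n ≡ suc (2 * h))
even-or-odd zero    = inj₁ (0 , refl)
even-or-odd (suc n) with even-or-odd n
... | inj₁ (h , refl) = inj₂ (h , refl)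
... | inj₂ (h , refl) = inj₁ (suc h , ≡.sym (ℕ.*-suc 2 h))

odd-part : ∀ d → 1 ≤ d → ∃₂ λ c h → d ≡ 2 ^ c * suc (2 * h)
odd-part d = go d (<-wellFounded d)
  where
  go : ∀ d → Acc _<_ d → 1 ≤ d → ∃₂ λ c h → d ≡ 2 ^ c * suc (2 * h)
  go d (acc rec) 1≤d with even-or-odd d
  ... | inj₂ (h , d≡1+2h) = 0 , h , ≡.trans d≡1+2h (≡.sym (ℕ.*-identityˡ _))
  ... | inj₁ (suc h , refl) with go (suc h) (rec (ℕ.m<m+n (suc h) (s≤s z≤n))) (s≤s z≤n)
  ...   | c , k , 1+h≡ = suc c , k , ≡.trans (cong (2 *_) 1+h≡) (≡.sym (ℕ.*-assoc 2 (2 ^ c) (suc (2 * k))))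

odd-coprime-2 : ∀ h → Coprime (suc (2 * h)) 2
odd-coprime-2 zero    = 1-coprimeTo 2
odd-coprime-2 (suc h) = ≡.subst (λ g → Coprime g 2) (cong suc (≡.sym (ℕ.*-suc 2 h))) (coprime-+ (odd-coprime-2 h))

odd∣2^s*t⇒∣t : ∀ s {h t} → suc (2 * h) ∣ 2 ^ s * t → suc (2 * h) ∣ t
odd∣2^s*t⇒∣t zero    {t = t} g∣t = ≡.subst (_ ∣_) (ℕ.*-identityˡ t) g∣t
odd∣2^s*t⇒∣t (suc s) {h} {t} g∣2^[1+s]t =
  odd∣2^s*t⇒∣t s {h} (coprime-divisor (odd-coprime-2 h) (≡.subst (suc (2 * h) ∣_) (ℕ.*-assoc 2 (2 ^ s) t) g∣2^[1+s]t))

[1+q]^[m/2]*qintAt∣negQPoch*qbinom : ∀ m a t n c h → 1 ≤ a * t → 1 ≤ n → suc (2 * h) ∣ t →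
  2 ^ c * suc (2 * h) ≡ gcd (a * t) n → 2 ^ c * suc (2 * h) ≤ 2 * suc m →
  (1+q^ 1) ^P (m / 2) *P qintAt a t ∣ₚ negQPoch (suc m) *P qbinom (a * t) n
[1+q]^[m/2]*qintAt∣negQPoch*qbinom m a t n c h 1≤N 1≤n g∣t 2^c*g≡gcd 2^c*g≤2m =
  ∣ʳ-respʳ-≈ (begin
    W *P (chainProd g c *P B)     ≈⟨ swap W (chainProd g c) B ⟩
    (chainProd g c *P W) *P B     ≈⟨ *P-congʳ B (≋-sym (negQPoch-chainProd c (suc m) (s≤s z≤n) 2^c*g≤2m)) ⟩
    negQPoch (suc m) *P B         ∎)
  (∙-cong-∣ ([1+q]^[m/2]∣negQPochWithout (inChain g c) m (inChain-odd c))
            (qintAt∣chainProd*qbinom a t {n} {g} {c} 1≤N 1≤n (s≤s z≤n) g∣t 2^c*g≡gcd))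
  where
  g = suc (2 * h)
  W = negQPochWithout (inChain g c) (suc m)
  B = qbinom (a * t) n
  swap : ∀ x y z → x *P (y *P z) ≋ (y *P x) *P z
  swap = solve-∀ ℤ[q]-solver

lemma2p2 : (m n s t : ℕ) → 1 ≤ m → 1 ≤ n → 1 ≤ s → 1 ≤ t
    → n ≤ 2 * m → ¬ (2 ∣ t)
    → ((oneP +P X^ 1) ^P ((m ∸ 1) / 2)) *P qintAt (2 ^ s) t
    ∣P negQPoch m *P qbinom (2 ^ s * t) n
lemma2p2 (suc m) n s t _ 1≤n _ 1≤t n≤2m _ = ∣ₚ⇒∣P (from-odd-part (odd-part (gcd N n) 1≤gcd))
  where
  N = 2 ^ s * t
  1≤N : 1 ≤ N
  1≤N = ℕ.*-mono-≤ (ℕ.m^n>0 2 s) 1≤t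
  1≤gcd : 1 ≤ gcd N n
  1≤gcd = ℕ.n≢0⇒n>0 (gcd[m,n]≢0 N n (inj₂ (ℕ.m<n⇒n≢0 1≤n)))
  from-odd-part : (∃₂ λ c h → gcd N n ≡ 2 ^ c * suc (2 * h)) →
                  (1+q^ 1) ^P (m / 2) *P qintAt (2 ^ s) t ∣ₚ negQPoch (suc m) *P qbinom N n
  from-odd-part (c , h , gcd≡2^c*g) = [1+q]^[m/2]*qintAt∣negQPoch*qbinom m (2 ^ s) t n c h 1≤N 1≤n
    (odd∣2^s*t⇒∣t s {h} (∣-trans (divides (2 ^ c) gcd≡2^c*g) (gcd[m,n]∣m N n)))
    (≡.sym gcd≡2^c*g)
    (ℕ.≤-trans (ℕ.≤-reflexive (≡.sym gcd≡2^c*g)) (ℕ.≤-trans (∣⇒≤ {{ℕ.>-nonZero 1≤n}} (gcd[m,n]∣n N n)) n≤2m))
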